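{- Let $\mathbf t:\mathcal D\to\mathcal T$ be a functor and $c:A\to B$ a morphism of $\mathcal T$. For any presheaves $\psi$ on $B^-$, $\rho$ on $B^+$ and $\sigma$ on $A^-$: (a) there is a natural isomorphism $(c^+)^*({}^\perp\psi)\cong{}^\perp\big((c^-)_!\psi\big)$ of presheaves on $A^+$; (b) there is a morphism of presheaves on $A^-$ (natural transformation) $(c^-)_!(\rho^\perp)\to\big((c^+)^*\rho\big)^\perp$; (c) there is a morphism of presheaves on $B^+$ (natural transformation) $(c^+)_!({}^\perp\sigma)\to{}^\perp\big((c^-)^*\sigma\big)$.
   Context: $P\sqsubset A$ means $\mathbf t(P)=A$; composition is diagrammatic ($c;d$ = $c$ then $d$); a derivation $\alpha:P\Rightarrow_c Q$ is a morphism of $\mathcal D$ with $\mathbf t(\alpha)=c$. For a type $X$: $X^+$ has objects $(P,c)$ with $c:\mathbf t(P)\to X$ and morphisms $(P_1,c_1)\to(P_2,c_2)$ derivations $\alpha:P_1\Rightarrow_e P_2$ with $c_1=e;c_2$; the coslice of $X$ has objects $(d,R)$ with $d:X\to\mathbf t(R)$ and morphisms $(d_1,R_1)\to(d_2,R_2)$ derivations $\gamma:R_1\Rightarrow_e R_2$ with $d_1;e=d_2$, and $X^-$ is its opposite. For $c:A\to B$: $c^+:A^+\to B^+$, $(P,d)\mapsto(P,d;c)$; $c^-:B^-\to A^-$ induced by $(d,R)\mapsto(c;d,R)$; both act as identity on derivations. $J(\mathbf t)$: objects triples $(P,c,Q)$ with $c:\mathbf t(P)\to\mathbf t(Q)$;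 morphisms $(P_1,c_1,Q_1)\to(P_2,c_2,Q_2)$ pairs $\beta:P_1\Rightarrow_e P_2$, $\gamma:Q_2\Rightarrow_{e'}Q_1$ with $c_1=e;c_2;e'$. $\mathrm{Der}$ on $J(\mathbf t)$: $(P,c,Q)\mapsto\{$derivations $P\Rightarrow_c Q\}$, acting by $\alpha\mapsto\beta;\alpha;\gamma$. Bracket $\langle-,-\rangle_X:X^+\times X^-\to J(\mathbf t)$: $((P,c),(d,R))\mapsto(P,c;d,R)$, $(\alpha,\gamma)\mapsto(\alpha,\gamma)$. For a presheaf $\varphi$ on $X^+$, $\varphi^\perp$ is the presheaf on $X^-$, $y\mapsto\mathrm{Nat}(\varphi,\mathrm{Der}(\langle-,y\rangle_X))$; for $\psi$ on $X^-$, ${}^\perp\psi$ is the presheaf on $X^+$, $x\mapsto\mathrm{Nat}(\psi,\mathrm{Der}(\langle x,-\rangle_X))$. For a functor $F:\mathcal X\to\mathcal Y$ and presheaves $\chi$ on $\mathcal X$, $\psi$ on $\mathcal Y$: $F^*\psi=\psi\circ F^{op}$, $F_!\chi(y)=\int^x\mathcal Y(y,Fx)\times\chi(x)$. -}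

module Defs where

-- Everything lives in a
-- single universe level ℓ (small categories, presheaves valued in
-- ℓ-small setoids).

open import Level using (Level; suc; _⊔_)
open import Data.Product using (Σ; Σ-syntax; _,_; proj₁; proj₂; _×_)
open import Relation.Binary using (Rel; IsEquivalence; Setoid)
import Relation.Binary.Reasoning.Setoid as SetoidR
open import Relation.Binary.Construct.Closure.Equivalence as EqC
  using (EqClosure)
open import Relation.Binary.Construct.Closure.ReflexiveTransitive
  using (ε; _◅_)
open import Relation.Binary.Construct.Closure.Symmetric using (fwd; bwd)

-- Categories (composition written diagrammatically: f ⨾ g = f then g)

record Category (ℓ : Level) : Set (suc ℓ) where
  infix  4 _≈_
  infixl 7 _⨾_
  field
    Obj   : Set ℓ
    _⇒_   : Obj → Obj → Set ℓ
    _≈_   : ∀ {A B} → Rel (A ⇒ B) ℓ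
    id    : ∀ {A} → A ⇒ A
    _⨾_   : ∀ {A B C} → A ⇒ B → B ⇒ C → A ⇒ C
    equiv : ∀ {A B} → IsEquivalence (_≈_ {A} {B})
    ⨾-resp : ∀ {A B C} {f f' : A ⇒ B} {g g' : B ⇒ C} →
             f ≈ f' → g ≈ g' → f ⨾ g ≈ f' ⨾ g'
    idˡ   : ∀ {A B} {f : A ⇒ B} → id ⨾ f ≈ f
    idʳ   : ∀ {A B} {f : A ⇒ B} → f ⨾ id ≈ f
    assoc : ∀ {A B C D} {f : A ⇒ B} {g : B ⇒ C} {h : C ⇒ D} →
            (f ⨾ g) ⨾ h ≈ f ⨾ (g ⨾ h)

  hom : Obj → Obj → Setoid ℓ ℓ
  hom A B = record { Carrier = A ⇒ B ; _≈_ = _≈_ ; isEquivalence = equiv }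

  module _ {A B : Obj} where
    open IsEquivalence (equiv {A} {B}) public
      renaming (refl to ≈-refl; sym to ≈-sym; trans to ≈-trans)

  module HomR {A B : Obj} = SetoidR (hom A B)

open Category

Op : ∀ {ℓ} → Category ℓ → Category ℓ
Op C = record
  { Obj = Obj C ; _⇒_ = λ A B → _⇒_ C B A ; _≈_ = _≈_ C ; id = id C
  ; _⨾_ = λ f g → _⨾_ C g f ; equiv = equiv C
  ; ⨾-resp = λ p q → ⨾-resp C q p ; idˡ = idʳ C ; idʳ = idˡ C
  ; assoc = ≈-sym C (assoc C) }

record Functor {ℓ} (C E : Category ℓ) : Set ℓ where
  field
    F₀     : Obj C → Obj E
    F₁     : ∀ {A B} → _⇒_ C A B → _⇒_ E (F₀ A) (F₀ B)
    F-resp : ∀ {A B} {f g : _⇒_ C A B} → _≈_ C f g → _≈_ E (F₁ f) (F₁ g)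
    F-id   : ∀ {A} → _≈_ E (F₁ (id C {A})) (id E)
    F-⨾    : ∀ {A B D} {f : _⇒_ C A B} {g : _⇒_ C B D} →
             _≈_ E (F₁ (_⨾_ C f g)) (_⨾_ E (F₁ f) (F₁ g))

open Functor

record Presheaf {ℓ} (C : Category ℓ) : Set (suc ℓ) where
  field
    at       : Obj C → Setoid ℓ ℓ
    act      : ∀ {x y} → _⇒_ C x y → Setoid.Carrier (at y) → Setoid.Carrier (at x)
    act-resp : ∀ {x y} {f g : _⇒_ C x y} {a b : Setoid.Carrier (at y)} →
               _≈_ C f g → Setoid._≈_ (at y) a b →
               Setoid._≈_ (at x) (act f a) (act g b)
    act-id   : ∀ {x} {a : Setoid.Carrier (at x)} → Setoid._≈_ (at x) (act (id C) a) a
    act-⨾    : ∀ {x y z} {f : _⇒_ C x y} {g : _⇒_ C y z} {a : Setoid.Carrier (at z)} →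
               Setoid._≈_ (at x) (act (_⨾_ C f g) a) (act f (act g a))

  ∣_∣ : Obj C → Set ℓ
  ∣ x ∣ = Setoid.Carrier (at x)

  _≋_ : ∀ {x} → Rel ∣ x ∣ ℓ
  _≋_ {x} = Setoid._≈_ (at x)

record NatTrans {ℓ} {C : Category ℓ} (φ ψ : Presheaf C) : Set ℓ where
  private
    module φ = Presheaf φ
    module ψ = Presheaf ψ
  field
    η       : ∀ x → φ.∣ x ∣ → ψ.∣ x ∣
    η-cong  : ∀ x {a b} → a φ.≋ b → η x a ψ.≋ η x b
    natural : ∀ {x y} (f : _⇒_ C x y) (a : φ.∣ y ∣) →
              η x (φ.act f a) ψ.≋ ψ.act f (η y a)

open NatTrans

NatSetoid : ∀ {ℓ} {C : Category ℓ} (φ ψ : Presheaf C) → Setoid ℓ ℓ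
NatSetoid {C = C} φ ψ = record
  { Carrier = NatTrans φ ψ
  ; _≈_ = λ α β → ∀ x (a : Presheaf.∣ φ ∣ x) → Presheaf._≋_ ψ (η α x a) (η β x a)
  ; isEquivalence = record
    { refl = λ x a → Setoid.refl (Presheaf.at ψ x)
    ; sym = λ p x a → Setoid.sym (Presheaf.at ψ x) (p x a)
    ; trans = λ p q x a → Setoid.trans (Presheaf.at ψ x) (p x a) (q x a) } }

record NatIso {ℓ} {C : Category ℓ} (φ ψ : Presheaf C) : Set ℓ where
  field
    to    : NatTrans φ ψ
    from  : NatTrans ψ φ
    from∘to : ∀ x (a : Presheaf.∣ φ ∣ x) → Presheaf._≋_ φ (η from x (η to x a)) a
    to∘from : ∀ x (b : Presheaf.∣ ψ ∣ x) → Presheaf._≋_ ψ (η to x (η from x b)) b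

-- Restriction F^* ψ = ψ ∘ F^op

pull : ∀ {ℓ} {X Y : Category ℓ} → Functor X Y → Presheaf Y → Presheaf X
pull {X = X} {Y} F ψ = record
  { at = λ x → ψ.at (F₀ F x)
  ; act = λ f → ψ.act (F₁ F f)
  ; act-resp = λ p q → ψ.act-resp (F-resp F p) q
  ; act-id = λ {x} → Setoid.trans (ψ.at (F₀ F x))
                       (ψ.act-resp (F-id F) (Setoid.refl (ψ.at (F₀ F x)))) ψ.act-id
  ; act-⨾ = λ {x} → Setoid.trans (ψ.at (F₀ F x))
                       (ψ.act-resp (F-⨾ F) (Setoid.refl (ψ.at (F₀ F _)))) ψ.act-⨾ }
  where module ψ = Presheaf ψ

-- Left Kan extension F_! χ (y) = ∫^x Y(y, F x) × χ(x), as the quotient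
-- (setoid) of  Σ x, Y(y,Fx) × χ(x)  by the equivalence relation generated
-- by  (x', f ⨾ F h, a') ∼ (x, f, h·a')  for h : x → x' (and by the
-- equalities of the hom-setoids and of χ).

module CoendDef {ℓ} {X Y : Category ℓ} (F : Functor X Y) (χ : Presheaf X) where
  private module χ = Presheaf χ

  Elt : Obj Y → Set ℓ
  Elt y = Σ[ x ∈ Obj X ] (_⇒_ Y y (F₀ F x) × χ.∣ x ∣)

  data Step (y : Obj Y) : Rel (Elt y) ℓ where
    eq-step : ∀ {x} {f g : _⇒_ Y y (F₀ F x)} {a b : χ.∣ x ∣} →
              _≈_ Y f g → a χ.≋ b → Step y (x , f , a) (x , g , b)
    dinat   : ∀ {x x'} (h : _⇒_ X x x') (f : _⇒_ Y y (F₀ F x)) (a : χ.∣ x' ∣) →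
              Step y (x' , _⨾_ Y f (F₁ F h) , a) (x , f , χ.act h a)

  CoendSetoid : Obj Y → Setoid ℓ ℓ
  CoendSetoid y = EqC.setoid (Step y)

  restr : ∀ {y' y} → _⇒_ Y y' y → Elt y → Elt y'
  restr g (x , f , a) = x , _⨾_ Y g f , a

  one : ∀ {y} {p q : Elt y} → Step y p q → EqClosure (Step y) p q
  one s = fwd s ◅ ε

  restr-step : ∀ {y' y} (g : _⇒_ Y y' y) {p q : Elt y} →
               Step y p q → EqClosure (Step y') (restr g p) (restr g q)
  restr-step g (eq-step p q) = one (eq-step (⨾-resp Y (≈-refl Y) p) q)
  restr-step g (dinat h f a) =
    fwd (eq-step (≈-sym Y (assoc Y)) (Setoid.refl (χ.at _))) ◅ one (dinat h (_⨾_ Y g f) a)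

  restr-cong : ∀ {y' y} {g g' : _⇒_ Y y' y} {p q : Elt y} →
               _≈_ Y g g' → EqClosure (Step y) p q →
               EqClosure (Step y') (restr g p) (restr g' q)
  restr-cong {y'} {g = g} {g'} {p} gg pq =
    EqC.transitive (Step y') (one (eq-step (⨾-resp Y gg (≈-refl Y)) (Setoid.refl (χ.at _))))
      (EqC.gfold (EqC.isEquivalence (Step y')) (restr g') (restr-step g') pq)

push : ∀ {ℓ} {X Y : Category ℓ} → Functor X Y → Presheaf X → Presheaf Y
push {X = X} {Y} F χ = record
  { at = CoendSetoid
  ; act = restr
  ; act-resp = restr-cong
  ; act-id = one (eq-step (idˡ Y) (Setoid.refl (Presheaf.at χ _)))
  ; act-⨾ = one (eq-step (assoc Y) (Setoid.refl (Presheaf.at χ _))) }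
  where open CoendDef F χ

module CatLemmas {ℓ} (C : Category ℓ) where
  open Category C using () renaming (_⇒_ to _⇛_; _≈_ to _≃_; id to i; _⨾_ to _∙_;
    ⨾-resp to ∙-resp; idˡ to iˡ; idʳ to iʳ; assoc to as; ≈-refl to rf; ≈-sym to sy; ≈-trans to tr)
  open Category.HomR C

  lemA : ∀ {P Q R S} (α : P ⇛ Q) (e : Q ⇛ R) (γ : R ⇛ S) →
         (i ∙ ((α ∙ e) ∙ i)) ∙ γ ≃ (α ∙ ((i ∙ e) ∙ γ)) ∙ i
  lemA α e γ = begin
    (i ∙ ((α ∙ e) ∙ i)) ∙ γ ≈⟨ ∙-resp (tr iˡ iʳ) rf ⟩
    (α ∙ e) ∙ γ ≈⟨ as ⟩
    α ∙ (e ∙ γ) ≈⟨ ∙-resp rf (∙-resp (sy iˡ) rf) ⟩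
    α ∙ ((i ∙ e) ∙ γ) ≈⟨ sy iʳ ⟩
    (α ∙ ((i ∙ e) ∙ γ)) ∙ i ∎

  lemB : ∀ {P Q R S} (e : P ⇛ Q) (a : Q ⇛ R) (b : R ⇛ S) →
         (i ∙ e) ∙ (a ∙ b) ≃ (i ∙ ((i ∙ e) ∙ a)) ∙ b
  lemB e a b = begin
    (i ∙ e) ∙ (a ∙ b) ≈⟨ sy as ⟩
    ((i ∙ e) ∙ a) ∙ b ≈⟨ ∙-resp (sy iˡ) rf ⟩
    (i ∙ ((i ∙ e) ∙ a)) ∙ b ∎

  lemC : ∀ {P Q R S} (a : P ⇛ Q) (b : Q ⇛ R) (e : R ⇛ S) →
         ((a ∙ b) ∙ e) ∙ i ≃ (a ∙ ((b ∙ e) ∙ i)) ∙ i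
  lemC a b e = ∙-resp (tr as (∙-resp rf (sy iʳ))) rf

module Setting {ℓ} {𝒟 𝒯 : Category ℓ} (t : Functor 𝒟 𝒯) where
  private
    module D = Category 𝒟
    module T = Category 𝒯
  open T using () renaming (_⇒_ to _⇒T_; _≈_ to _≈T_; _⨾_ to _⨾T_)
  open D using () renaming (_⇒_ to _⇒D_; _≈_ to _≈D_; _⨾_ to _⨾D_)

  𝐭 : ∀ {P Q} → P ⇒D Q → F₀ t P ⇒T F₀ t Q
  𝐭 = F₁ t

  Derivation : (P Q : D.Obj) → F₀ t P ⇒T F₀ t Q → Set ℓ
  Derivation P Q c = Σ[ α ∈ P ⇒D Q ] (𝐭 α ≈T c)

  Plus : T.Obj → Category ℓ
  Plus X = record
    { Obj = Σ[ P ∈ D.Obj ] (F₀ t P ⇒T X)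
    ; _⇒_ = λ { (P₁ , c₁) (P₂ , c₂) → Σ[ α ∈ P₁ ⇒D P₂ ] (c₁ ≈T (𝐭 α ⨾T c₂)) }
    ; _≈_ = λ f g → proj₁ f ≈D proj₁ g
    ; id = D.id , T.≈-trans (T.≈-sym T.idˡ) (T.⨾-resp (T.≈-sym (F-id t)) T.≈-refl)
    ; _⨾_ = λ { (α , p) (β , q) → (α ⨾D β) ,
        T.≈-trans p (T.≈-trans (T.⨾-resp T.≈-refl q)
          (T.≈-trans (T.≈-sym T.assoc) (T.⨾-resp (T.≈-sym (F-⨾ t)) T.≈-refl))) }
    ; equiv = record { refl = D.≈-refl ; sym = D.≈-sym ; trans = D.≈-trans }
    ; ⨾-resp = D.⨾-resp ; idˡ = D.idˡ ; idʳ = D.idʳ ; assoc = D.assoc }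

  -- coslice X/𝐭 : objects (d , R) with d : X → 𝐭 R (stored as (R , d))
  Coslice : T.Obj → Category ℓ
  Coslice X = record
    { Obj = Σ[ R ∈ D.Obj ] (X ⇒T F₀ t R)
    ; _⇒_ = λ { (R₁ , d₁) (R₂ , d₂) → Σ[ γ ∈ R₁ ⇒D R₂ ] ((d₁ ⨾T 𝐭 γ) ≈T d₂) }
    ; _≈_ = λ f g → proj₁ f ≈D proj₁ g
    ; id = D.id , T.≈-trans (T.⨾-resp T.≈-refl (F-id t)) T.idʳ
    ; _⨾_ = λ { (α , p) (β , q) → (α ⨾D β) ,
        T.≈-trans (T.⨾-resp T.≈-refl (F-⨾ t))
          (T.≈-trans (T.≈-sym T.assoc) (T.≈-trans (T.⨾-resp p T.≈-refl) q)) }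
    ; equiv = record { refl = D.≈-refl ; sym = D.≈-sym ; trans = D.≈-trans }
    ; ⨾-resp = D.⨾-resp ; idˡ = D.idˡ ; idʳ = D.idʳ ; assoc = D.assoc }

  Minus : T.Obj → Category ℓ
  Minus X = Op (Coslice X)

  plusF : ∀ {A B} → A ⇒T B → Functor (Plus A) (Plus B)
  plusF c = record
    { F₀ = λ { (P , d) → P , (d ⨾T c) }
    ; F₁ = λ { (α , p) → α , T.≈-trans (T.⨾-resp p T.≈-refl) T.assoc }
    ; F-resp = λ p → p ; F-id = D.≈-refl ; F-⨾ = D.≈-refl }

  minusF : ∀ {A B} → A ⇒T B → Functor (Minus B) (Minus A)
  minusF c = record
    { F₀ = λ { (R , d) → R , (c ⨾T d) }
    ; F₁ = λ { (γ , p) → γ , T.≈-trans T.assoc (T.⨾-resp T.≈-refl p) }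
    ; F-resp = λ p → p ; F-id = D.≈-refl ; F-⨾ = D.≈-refl }

  JObj : Set ℓ
  JObj = Σ[ P ∈ D.Obj ] Σ[ Q ∈ D.Obj ] (F₀ t P ⇒T F₀ t Q)

  JHom : JObj → JObj → Set ℓ
  JHom (P₁ , Q₁ , c₁) (P₂ , Q₂ , c₂) =
    Σ[ β ∈ P₁ ⇒D P₂ ] Σ[ γ ∈ Q₂ ⇒D Q₁ ] (c₁ ≈T ((𝐭 β ⨾T c₂) ⨾T 𝐭 γ))

  private
    open T.HomR
    Jcomp-proof : ∀ {P₁ Q₁ P₂ Q₂ P₃ Q₃} {c₁ : F₀ t P₁ ⇒T F₀ t Q₁}
      {c₂ : F₀ t P₂ ⇒T F₀ t Q₂} {c₃ : F₀ t P₃ ⇒T F₀ t Q₃}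
      {β : P₁ ⇒D P₂} {γ : Q₂ ⇒D Q₁} {β' : P₂ ⇒D P₃} {γ' : Q₃ ⇒D Q₂} →
      c₁ ≈T ((𝐭 β ⨾T c₂) ⨾T 𝐭 γ) → c₂ ≈T ((𝐭 β' ⨾T c₃) ⨾T 𝐭 γ') →
      c₁ ≈T ((𝐭 (β ⨾D β') ⨾T c₃) ⨾T 𝐭 (γ' ⨾D γ))
    Jcomp-proof {c₃ = c₃} {β} {γ} {β'} {γ'} p q = begin
      _ ≈⟨ p ⟩
      (𝐭 β ⨾T _) ⨾T 𝐭 γ ≈⟨ T.⨾-resp (T.⨾-resp T.≈-refl q) T.≈-refl ⟩
      (𝐭 β ⨾T ((𝐭 β' ⨾T c₃) ⨾T 𝐭 γ')) ⨾T 𝐭 γ ≈⟨ T.⨾-resp (T.≈-sym T.assoc) T.≈-refl ⟩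
      ((𝐭 β ⨾T (𝐭 β' ⨾T c₃)) ⨾T 𝐭 γ') ⨾T 𝐭 γ ≈⟨ T.assoc ⟩
      (𝐭 β ⨾T (𝐭 β' ⨾T c₃)) ⨾T (𝐭 γ' ⨾T 𝐭 γ) ≈⟨ T.⨾-resp (T.≈-sym T.assoc) (T.≈-sym (F-⨾ t)) ⟩
      ((𝐭 β ⨾T 𝐭 β') ⨾T c₃) ⨾T 𝐭 (γ' ⨾D γ) ≈⟨ T.⨾-resp (T.⨾-resp (T.≈-sym (F-⨾ t)) T.≈-refl) T.≈-refl ⟩
      (𝐭 (β ⨾D β') ⨾T c₃) ⨾T 𝐭 (γ' ⨾D γ) ∎

    Jid-proof : ∀ {P Q} {c : F₀ t P ⇒T F₀ t Q} → c ≈T ((𝐭 D.id ⨾T c) ⨾T 𝐭 D.id)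
    Jid-proof {c = c} = begin
      c ≈⟨ T.≈-sym T.idʳ ⟩
      c ⨾T T.id ≈⟨ T.⨾-resp (T.≈-sym T.idˡ) T.≈-refl ⟩
      (T.id ⨾T c) ⨾T T.id ≈⟨ T.⨾-resp (T.⨾-resp (T.≈-sym (F-id t)) T.≈-refl) (T.≈-sym (F-id t)) ⟩
      (𝐭 D.id ⨾T c) ⨾T 𝐭 D.id ∎

  J : Category ℓ
  J = record
    { Obj = JObj
    ; _⇒_ = JHom
    ; _≈_ = λ f g → (proj₁ f ≈D proj₁ g) × (proj₁ (proj₂ f) ≈D proj₁ (proj₂ g))
    ; id = D.id , D.id , Jid-proof
    ; _⨾_ = λ { (β , γ , p) (β' , γ' , q) → (β ⨾D β') , (γ' ⨾D γ) , Jcomp-proof p q }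
    ; equiv = record
      { refl = D.≈-refl , D.≈-refl
      ; sym = λ { (p , q) → D.≈-sym p , D.≈-sym q }
      ; trans = λ { (p , q) (p' , q') → D.≈-trans p p' , D.≈-trans q q' } }
    ; ⨾-resp = λ { (p , q) (p' , q') → D.⨾-resp p p' , D.⨾-resp q' q }
    ; idˡ = D.idˡ , D.idʳ
    ; idʳ = D.idʳ , D.idˡ
    ; assoc = D.assoc , D.≈-sym D.assoc }

  private
    Der-act-proof : ∀ {P₁ Q₁ P₂ Q₂} {c₁ : F₀ t P₁ ⇒T F₀ t Q₁}
      {c₂ : F₀ t P₂ ⇒T F₀ t Q₂} {β : P₁ ⇒D P₂} {γ : Q₂ ⇒D Q₁} {α : P₂ ⇒D Q₂} →
      c₁ ≈T ((𝐭 β ⨾T c₂) ⨾T 𝐭 γ) → 𝐭 α ≈T c₂ → 𝐭 ((β ⨾D α) ⨾D γ) ≈T c₁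
    Der-act-proof {β = β} {γ} {α} p q = begin
      𝐭 ((β ⨾D α) ⨾D γ) ≈⟨ F-⨾ t ⟩
      𝐭 (β ⨾D α) ⨾T 𝐭 γ ≈⟨ T.⨾-resp (F-⨾ t) T.≈-refl ⟩
      (𝐭 β ⨾T 𝐭 α) ⨾T 𝐭 γ ≈⟨ T.⨾-resp (T.⨾-resp T.≈-refl q) T.≈-refl ⟩
      (𝐭 β ⨾T _) ⨾T 𝐭 γ ≈⟨ T.≈-sym p ⟩
      _ ∎

  Der : Presheaf J
  Der = record
    { at = λ { (P , Q , c) → record
        { Carrier = Derivation P Q c
        ; _≈_ = λ a b → proj₁ a ≈D proj₁ b
        ; isEquivalence = record { refl = D.≈-refl ; sym = D.≈-sym ; trans = D.≈-trans } } }
    ; act = λ { (β , γ , p) (α , q) → ((β ⨾D α) ⨾D γ) , Der-act-proof p q }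
    ; act-resp = λ { (p , q) r → D.⨾-resp (D.⨾-resp p r) q }
    ; act-id = D.≈-trans D.idʳ D.idˡ
    ; act-⨾ = λ { {f = β , γ , _} {g = β' , γ' , _} {a = α , _} →
        D.≈-trans (D.≈-sym D.assoc) (D.≈-trans
          (D.⨾-resp (D.⨾-resp D.assoc D.≈-refl) D.≈-refl)
          (D.⨾-resp D.assoc D.≈-refl)) } }

  -- the bracket ⟨-,-⟩_X : X⁺ × X⁻ → J(𝐭), ((P,c),(d,R)) ↦ (P, c⨾d, R),
  -- (α,γ) ↦ (α,γ); given through its two partial functors
  -- ⟨-, y⟩_X : X⁺ → J(𝐭)   and   ⟨x, -⟩_X : X⁻ → J(𝐭).
  bracket₀ : ∀ {X} → Obj (Plus X) → Obj (Minus X) → JObj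
  bracket₀ (P , c) (R , d) = P , R , (c ⨾T d)

  bracketL : ∀ {X} → Obj (Minus X) → Functor (Plus X) J
  bracketL (R , d) = record
    { F₀ = λ x → bracket₀ x (R , d)
    ; F₁ = λ { {P₁ , c₁} {P₂ , c₂} (α , p) → α , D.id ,
        (begin
          c₁ ⨾T d ≈⟨ T.⨾-resp p T.≈-refl ⟩
          (𝐭 α ⨾T c₂) ⨾T d ≈⟨ T.assoc ⟩
          𝐭 α ⨾T (c₂ ⨾T d) ≈⟨ T.≈-sym T.idʳ ⟩
          (𝐭 α ⨾T (c₂ ⨾T d)) ⨾T T.id ≈⟨ T.⨾-resp T.≈-refl (T.≈-sym (F-id t)) ⟩
          (𝐭 α ⨾T (c₂ ⨾T d)) ⨾T 𝐭 D.id ∎) }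
    ; F-resp = λ p → p , D.≈-refl
    ; F-id = D.≈-refl , D.≈-refl
    ; F-⨾ = D.≈-refl , D.≈-sym D.idˡ }

  bracketR : ∀ {X} → Obj (Plus X) → Functor (Minus X) J
  bracketR (P , c) = record
    { F₀ = λ y → bracket₀ (P , c) y
    ; F₁ = λ { {R₁ , d₁} {R₂ , d₂} (γ , p) → D.id , γ ,
        (begin
          c ⨾T d₁ ≈⟨ T.⨾-resp T.≈-refl (T.≈-sym p) ⟩
          c ⨾T (d₂ ⨾T 𝐭 γ) ≈⟨ T.≈-sym T.assoc ⟩
          (c ⨾T d₂) ⨾T 𝐭 γ ≈⟨ T.⨾-resp (T.≈-sym T.idˡ) T.≈-refl ⟩
          (T.id ⨾T (c ⨾T d₂)) ⨾T 𝐭 γ ≈⟨ T.⨾-resp (T.⨾-resp (T.≈-sym (F-id t)) T.≈-refl) T.≈-refl ⟩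
          (𝐭 D.id ⨾T (c ⨾T d₂)) ⨾T 𝐭 γ ∎) }
    ; F-resp = λ p → D.≈-refl , p
    ; F-id = D.≈-refl , D.≈-refl
    ; F-⨾ = D.≈-sym D.idˡ , D.≈-refl }

  DerL : ∀ {X} → Obj (Minus X) → Presheaf (Plus X)
  DerL y = pull (bracketL y) Der

  DerR : ∀ {X} → Obj (Plus X) → Presheaf (Minus X)
  DerR x = pull (bracketR x) Der

  private module CL = CatLemmas 𝒟

  -- φ^⊥ for φ a presheaf on X⁺:  y ↦ Nat(φ, Der(⟨-, y⟩_X)),
  -- functorial in y through ⟨x, -⟩_X.
  perpR : ∀ {X} → Presheaf (Plus X) → Presheaf (Minus X)
  perpR {X} φ = record
    { at = λ y → NatSetoid φ (DerL y)
    ; act = λ {y} {y'} g θ → record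
      { η = λ x a → Presheaf.act Der (F₁ (bracketR x) g) (η θ x a)
      ; η-cong = λ x p → D.⨾-resp (D.⨾-resp D.≈-refl (η-cong θ x p)) D.≈-refl
      ; natural = λ { {x₁} {x₂} (α , _) a →
          D.≈-trans (D.⨾-resp (D.⨾-resp D.≈-refl (natural θ (α , _) a)) D.≈-refl)
                    (CL.lemA α (proj₁ (η θ x₂ a)) (proj₁ g)) } }
    ; act-resp = λ p q x a → D.⨾-resp (D.⨾-resp D.≈-refl (q x a)) p
    ; act-id = λ x a → D.≈-trans D.idʳ D.idˡ
    ; act-⨾ = λ { {f = f} {g = g} {a = θ} x a →
        CL.lemB (proj₁ (η θ x a)) (proj₁ g) (proj₁ f) } }

  -- ⊥ψ for ψ a presheaf on X⁻:  x ↦ Nat(ψ, Der(⟨x, -⟩_X)),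
  -- functorial in x through ⟨-, y⟩_X.
  perpL : ∀ {X} → Presheaf (Minus X) → Presheaf (Plus X)
  perpL {X} ψ = record
    { at = λ x → NatSetoid ψ (DerR x)
    ; act = λ {x} {x'} f θ → record
      { η = λ y b → Presheaf.act Der (F₁ (bracketL y) f) (η θ y b)
      ; η-cong = λ y p → D.⨾-resp (D.⨾-resp D.≈-refl (η-cong θ y p)) D.≈-refl
      ; natural = λ { {y₁} {y₂} (γ , _) b →
          D.≈-trans (D.⨾-resp (D.⨾-resp D.≈-refl (natural θ (γ , _) b)) D.≈-refl)
                    (D.≈-sym (CL.lemA (proj₁ f) (proj₁ (η θ y₂ b)) γ)) } }
    ; act-resp = λ p q y b → D.⨾-resp (D.⨾-resp p (q y b)) D.≈-refl
    ; act-id = λ y b → D.≈-trans D.idʳ D.idˡ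
    ; act-⨾ = λ { {f = f} {g = g} {a = θ} y b →
        CL.lemC (proj₁ f) (proj₁ g) (proj₁ (η θ y b)) } }

module Submission where

-- Everything follows from two facts. First, push F is left adjoint to pull F:
-- a map out of the coend F_! χ is the same as a natural family χ x → φ (F x).
-- Second, the brackets satisfy ⟨c⁺ x, y⟩_B = ⟨x, c⁻ y⟩_A up to reassociating
-- (e ; c) ; d, so Der(⟨c⁺ x, -⟩_B) ≅ (c⁻)^* Der(⟨x, -⟩_A) and dually.
-- Composing ⊥-elements with this identification gives the maps
-- ⊥σ → (c⁺)^* ⊥((c⁻)^* σ) and ρ^⊥ → (c⁻)^* ((c⁺)^* ρ)^⊥, whose transposes are
-- (c) and (b); for (a), transposition is itself the isomorphism.

open import Defs
open import Data.Product using (_×_; _,_; proj₁)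
open import Relation.Binary using (Setoid)
open import Relation.Binary.Construct.Closure.Equivalence as EqC using ()
open import Relation.Binary.Construct.Closure.ReflexiveTransitive using (_◅_)
open import Relation.Binary.Construct.Closure.Symmetric using (bwd)
import Relation.Binary.Reasoning.Setoid as SetoidReasoning

open Category
open Functor
open NatTrans

infixl 7 _⨾ⁿ_

_⨾ⁿ_ : ∀ {ℓ} {C : Category ℓ} {φ ψ ω : Presheaf C} →
       NatTrans φ ψ → NatTrans ψ ω → NatTrans φ ω
_⨾ⁿ_ {ω = ω} θ κ = record
  { η = λ x a → η κ x (η θ x a)
  ; η-cong = λ x p → η-cong κ x (η-cong θ x p)
  ; natural = λ {x} f a →
      Setoid.trans (Presheaf.at ω x) (η-cong κ x (natural θ f a)) (natural κ f _) }

pull-map : ∀ {ℓ} {X Y : Category ℓ} (F : Functor X Y) {φ ψ : Presheaf Y} →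
           NatTrans φ ψ → NatTrans (pull F φ) (pull F ψ)
pull-map F θ = record
  { η = λ x → η θ (F₀ F x)
  ; η-cong = λ x → η-cong θ (F₀ F x)
  ; natural = λ f → natural θ (F₁ F f) }

module PushPull {ℓ} {X Y : Category ℓ} (F : Functor X Y)
                {χ : Presheaf X} {φ : Presheaf Y} where
  open CoendDef F χ
  private
    module χ = Presheaf χ
    module φ = Presheaf φ
    module φR {y} = SetoidReasoning (φ.at y)

  transpose : NatTrans χ (pull F φ) → NatTrans (push F χ) φ
  transpose θ = record
    { η = transpose-η
    ; η-cong = λ y → EqC.gfold (Setoid.isEquivalence (φ.at y)) (transpose-η y) (respects-step y)
    ; natural = λ { g (x , f , a) → φ.act-⨾ } }
    where
      transpose-η : ∀ y → Elt y → φ.∣ y ∣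
      transpose-η y (x , f , a) = φ.act f (η θ x a)

      respects-step : ∀ y {p q} → Step y p q → transpose-η y p φ.≋ transpose-η y q
      respects-step y (eq-step f≈g a≈b) = φ.act-resp f≈g (η-cong θ _ a≈b)
      respects-step y (dinat {x} {x'} h f a) = begin
        φ.act (_⨾_ Y f (F₁ F h)) (η θ x' a)   ≈⟨ φ.act-⨾ ⟩
        φ.act f (φ.act (F₁ F h) (η θ x' a))   ≈⟨ φ.act-resp (≈-refl Y) (natural θ h a) ⟨
        φ.act f (η θ x (χ.act h a))           ∎
        where open φR

  untranspose : NatTrans (push F χ) φ → NatTrans χ (pull F φ)
  untranspose Θ = record
    { η = λ x a → η Θ (F₀ F x) (x , id Y , a)
    ; η-cong = λ x a≈b → η-cong Θ _ (one (eq-step (≈-refl Y) a≈b))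
    ; natural = λ {x} {x'} h a → begin
        η Θ (F₀ F x) (x , id Y , χ.act h a)
          ≈⟨ η-cong Θ _ (bwd (dinat h (id Y) a) ◅
                          one (eq-step (≈-trans Y (idˡ Y) (≈-sym Y (idʳ Y))) (Setoid.refl (χ.at x')))) ⟩
        η Θ (F₀ F x) (x' , _⨾_ Y (F₁ F h) (id Y) , a)
          ≈⟨ natural Θ (F₁ F h) (x' , id Y , a) ⟩
        φ.act (F₁ F h) (η Θ (F₀ F x') (x' , id Y , a)) ∎ }
    where open φR

  transpose-cong : ∀ {θ θ'} → Setoid._≈_ (NatSetoid χ (pull F φ)) θ θ' →
                   Setoid._≈_ (NatSetoid (push F χ) φ) (transpose θ) (transpose θ')
  transpose-cong θ≈θ' y (x , f , a) = φ.act-resp (≈-refl Y) (θ≈θ' x a)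

  untranspose-transpose : ∀ θ → Setoid._≈_ (NatSetoid χ (pull F φ)) (untranspose (transpose θ)) θ
  untranspose-transpose θ x a = φ.act-id

  transpose-untranspose : ∀ Θ → Setoid._≈_ (NatSetoid (push F χ) φ) (transpose (untranspose Θ)) Θ
  transpose-untranspose Θ y (x , f , a) = begin
    φ.act f (η Θ (F₀ F x) (x , id Y , a)) ≈⟨ natural Θ f (x , id Y , a) ⟨
    η Θ y (x , _⨾_ Y f (id Y) , a)        ≈⟨ η-cong Θ y (one (eq-step (idʳ Y) (Setoid.refl (χ.at x)))) ⟩
    η Θ y (x , f , a)                     ∎
    where open φR

open PushPull

module PlusMinus {ℓ} {𝒟 𝒯 : Category ℓ} (t : Functor 𝒟 𝒯)
                 {A B : Obj 𝒯} (c : _⇒_ 𝒯 A B) where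
  open Setting t
  private
    module D = Category 𝒟
    module T = Category 𝒯

  derivation-resp : ∀ {P Q} {f g : _⇒_ 𝒯 (F₀ t P) (F₀ t Q)} →
                    _≈_ 𝒯 f g → Derivation P Q f → Derivation P Q g
  derivation-resp f≈g (α , 𝐭α≈f) = α , T.≈-trans 𝐭α≈f f≈g

  DerR-plusF≅ : ∀ x → NatIso (DerR (F₀ (plusF c) x)) (pull (minusF c) (DerR x))
  DerR-plusF≅ x = record
    { to = record
      { η = λ y → derivation-resp T.assoc
      ; η-cong = λ y p → p
      ; natural = λ g α → D.≈-refl }
    ; from = record
      { η = λ y → derivation-resp (T.≈-sym T.assoc)
      ; η-cong = λ y p → p
      ; natural = λ g α → D.≈-refl }
    ; from∘to = λ y α → D.≈-refl
    ; to∘from = λ y α → D.≈-refl }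

  pull-DerL⇒DerL-minusF : ∀ y → NatTrans (pull (plusF c) (DerL y)) (DerL (F₀ (minusF c) y))
  pull-DerL⇒DerL-minusF y = record
    { η = λ x → derivation-resp T.assoc
    ; η-cong = λ x p → p
    ; natural = λ f α → D.≈-refl }

  perpL-pull : (σ : Presheaf (Minus A)) →
               NatTrans (perpL σ) (pull (plusF c) (perpL (pull (minusF c) σ)))
  perpL-pull σ = record
    { η = λ x θ → pull-map (minusF c) θ ⨾ⁿ NatIso.from (DerR-plusF≅ x)
    ; η-cong = λ x θ≈θ' y b → θ≈θ' _ b
    ; natural = λ f θ y b → D.≈-refl }

  perpR-pull : (ρ : Presheaf (Plus B)) →
               NatTrans (perpR ρ) (pull (minusF c) (perpR (pull (plusF c) ρ)))
  perpR-pull ρ = record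
    { η = λ y θ → pull-map (plusF c) θ ⨾ⁿ pull-DerL⇒DerL-minusF y
    ; η-cong = λ y θ≈θ' x a → θ≈θ' _ a
    ; natural = λ g θ x a → D.≈-refl }

  pull-perpL≅perpL-push : (ψ : Presheaf (Minus B)) →
                          NatIso (pull (plusF c) (perpL ψ)) (perpL (push (minusF c) ψ))
  pull-perpL≅perpL-push ψ = record
    { to = record
      { η = λ x θ → transpose (minusF c) (θ ⨾ⁿ NatIso.to (DerR-plusF≅ x))
      ; η-cong = λ x {θ} {θ'} θ≈θ' →
          transpose-cong (minusF c) {φ = DerR x} {θ ⨾ⁿ NatIso.to (DerR-plusF≅ x)}
                                    {θ' ⨾ⁿ NatIso.to (DerR-plusF≅ x)} θ≈θ'
      -- the x-action of ⊥ (precomposition) commutes with the y-action of Der (postcomposition)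
      ; natural = λ { (β , _) θ y (y' , (γ , _) , b) →
          CatLemmas.lemA 𝒟 β (proj₁ (η θ y' b)) γ } }
    ; from = record
      { η = λ x Θ → untranspose (minusF c) Θ ⨾ⁿ NatIso.from (DerR-plusF≅ x)
      ; η-cong = λ x Θ≈Θ' y b → Θ≈Θ' _ (y , id (Minus A) , b)
      ; natural = λ f Θ y b → D.≈-refl }
    ; from∘to = λ x θ → untranspose-transpose (minusF c) {φ = DerR x}
                          (θ ⨾ⁿ NatIso.to (DerR-plusF≅ x))
    ; to∘from = λ x Θ → transpose-untranspose (minusF c) Θ }

open PlusMinus

corollary4p12 : ∀ {ℓ} (𝒟 𝒯 : Category ℓ) (t : Functor 𝒟 𝒯)
                  {A B : Category.Obj 𝒯} (c : Category._⇒_ 𝒯 A B) →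
                  let open Setting t in
                  ((ψ : Presheaf (Minus B)) →
                     NatIso (pull (plusF c) (perpL ψ)) (perpL (push (minusF c) ψ)))
                  × ((ρ : Presheaf (Plus B)) →
                     NatTrans (push (minusF c) (perpR ρ)) (perpR (pull (plusF c) ρ)))
                  × ((σ : Presheaf (Minus A)) →
                     NatTrans (push (plusF c) (perpL σ)) (perpL (pull (minusF c) σ)))
corollary4p12 𝒟 𝒯 t c =
    pull-perpL≅perpL-push t c
  , (λ ρ → transpose (Setting.minusF t c) (perpR-pull t c ρ))
  , (λ σ → transpose (Setting.plusF t c) (perpL-pull t c σ))
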